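{- Let $R\in\mathfrak{T}_a\cap\mathfrak{D}_r$. If for every $vw\in A(R)$ the set $[v,w]_R$ is (the vertex set of) a path in $R$, then $R\in\mathfrak{R}$.
   Context: A digraph $G=(V(G),A(G))$ has finite nonempty vertex set and arc set $A(G)\subseteq V(G)\times V(G)$; $vw$ denotes $(v,w)$; $G^*$ is $G$ with loops removed. $\mathfrak{D}_r$: reflexive digraphs; $\mathfrak{T}_a$: digraphs with $G^*$ acyclic. $\mathcal{H}(G,H)$: homomorphisms; $\mathcal{S}(G,H)=\mathcal{H}(G,H)\cap\mathcal{H}(G^*,H^*)$. A path is a sequence $P_0,\dots,P_{\ell(P)}$ of distinct vertices with $P_{i-1}P_i\in A(G)$ (in $G\in\mathfrak{T}_a$ determined by its vertex set). $h_G$: largest path length; $\mathcal{P}^h_G$: paths of length $h_G$; $P_\times$: digraph on $P$ with arcs $P_{i-1}P_i$; $\mathcal{L}(G)=\{P_\times:P\in\mathcal{P}^h_G\}$. $[v,w]_H=\{u:vu,uw\in A(H)\}$, $\iota(v,w)_H=\#[v,w]_H$; for $\xi\in\mathcal{H}(L,H)$, $\mu_\xi(L)=\sum_{vw\in A(L^*)}\iota(\xi(v),\xi(w))_H$; $\mathcal{M}(L,H)$: maximizers of $\mu_\xi(L)$ over $\mathcal{H}(L,H)$; $\mathcal{M}^{\mathcal{L}}(G,H)=\{\xi\in\mathcal{H}(G,H):\xi|_{V(L)}\in\mathcal{M}(L,H)\ \forall L\in\mathcal{L}\}$. $\mathfrak{R}$: the class of $R\in\mathfrak{T}_a\cap\mathfrak{D}_r$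 with $\mathcal{M}^{\mathcal{L}(R)}(R,R)\cap\mathcal{S}(R,R)\neq\emptyset$. -}

module Defs where

open import Data.Nat using (ℕ; zero; suc; _≤_)
open import Data.Fin using (Fin; inject₁) renaming (suc to fsuc)
open import Data.Bool using (Bool; true; false; _∧_; if_then_else_)
open import Data.List using (List; allFin; map)
open import Data.Nat.ListAction using (sum)
open import Data.Product using (Σ; _×_; ∃)
open import Relation.Binary.PropositionalEquality using (_≡_; _≢_)
open import Relation.Nullary using (¬_)
open import Function.Definitions using (Injective)
open import Function.Bundles using (_⇔_)

record Digraph : Set where
  field
    size : ℕ
    arc  : Fin (suc size) → Fin (suc size) → Bool

open Digraph public

V : Digraph → Set
V G = Fin (suc (size G))

Arc : (G : Digraph) → V G → V G → Set
Arc G v w = arc G v w ≡ true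

Arc* : (G : Digraph) → V G → V G → Set
Arc* G v w = Arc G v w × v ≢ w

Reflexive : Digraph → Set
Reflexive G = ∀ v → Arc G v v

data Reach⁺ (G : Digraph) : V G → V G → Set where
  step : ∀ {v w} → Arc* G v w → Reach⁺ G v w
  _∷_  : ∀ {u v w} → Arc* G u v → Reach⁺ G v w → Reach⁺ G u w

Acyclic* : Digraph → Set
Acyclic* G = ∀ v → ¬ Reach⁺ G v v

record Path (G : Digraph) (ℓ : ℕ) : Set where
  field
    vtx      : Fin (suc ℓ) → V G
    distinct : Injective _≡_ _≡_ vtx
    arcs     : ∀ (i : Fin ℓ) → Arc G (vtx (inject₁ i)) (vtx (fsuc i))

open Path public

IsLongestPath : (G : Digraph) (ℓ : ℕ) → Path G ℓ → Set
IsLongestPath G ℓ P = ∀ (k : ℕ) → Path G k → k ≤ ℓ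

InBetween : (H : Digraph) → V H → V H → V H → Set
InBetween H v w u = Arc H v u × Arc H u w

ι : (H : Digraph) → V H → V H → ℕ
ι H v w = sum (map (λ u → if arc H v u ∧ arc H u w then 1 else 0) (allFin (suc (size H))))

IsPathVertexSet : (H : Digraph) → (V H → Set) → Set
IsPathVertexSet H S = Σ ℕ λ ℓ → Σ (Path H ℓ) λ P →
  ∀ u → S u ⇔ (Σ (Fin (suc ℓ)) λ i → vtx P i ≡ u)

-- Homomorphisms P_× → H, where P_× is the digraph on the path vertices
-- P 0, …, P ℓ (indexed by Fin (suc ℓ)) with arcs P (i-1) P i.
IsHomPath : (ℓ : ℕ) (H : Digraph) → (Fin (suc ℓ) → V H) → Set
IsHomPath ℓ H f = ∀ (i : Fin ℓ) → Arc H (f (inject₁ i)) (f (fsuc i))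

-- μ_f(P_×) = Σ_{vw ∈ A(P_×^*)} ι(f v, f w)_H ; the arcs of P_×^* are exactly P (i-1) P i
μ : (ℓ : ℕ) (H : Digraph) → (Fin (suc ℓ) → V H) → ℕ
μ ℓ H f = sum (map (λ i → ι H (f (inject₁ i)) (f (fsuc i))) (allFin ℓ))

IsMaximizer : (ℓ : ℕ) (H : Digraph) → (Fin (suc ℓ) → V H) → Set
IsMaximizer ℓ H f = IsHomPath ℓ H f × (∀ g → IsHomPath ℓ H g → μ ℓ H g ≤ μ ℓ H f)

IsHom : (G H : Digraph) → (V G → V H) → Set
IsHom G H ξ = ∀ v w → Arc G v w → Arc H (ξ v) (ξ w)

IsStrictHom : (G H : Digraph) → (V G → V H) → Set
IsStrictHom G H ξ = IsHom G H ξ × (∀ v w → Arc* G v w → Arc* H (ξ v) (ξ w))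

-- ξ ∈ 𝓜^{𝓛(G)}(G,H): hom whose restriction to each L = P_× ∈ 𝓛(G) lies in 𝓜(L,H)
IsLMaximizer : (G H : Digraph) → (V G → V H) → Set
IsLMaximizer G H ξ = IsHom G H ξ ×
  (∀ (ℓ : ℕ) (P : Path G ℓ) → IsLongestPath G ℓ P →
     IsMaximizer ℓ H (λ i → ξ (vtx P i)))

InℜClass : Digraph → Set
InℜClass R = Reflexive R × Acyclic* R ×
  (Σ (V R → V R) λ ξ → IsLMaximizer R R ξ × IsStrictHom R R ξ)

module Submission where

-- The identity is trivially a strict homomorphism, so the content is that
-- for every longest path P (of length ℓ = h_R) the inclusion P_× → R
-- maximises μ among all homomorphisms g : P_× → R.  Two estimates on ι give
-- this.  Lower bound: for a non-loop arc xy both x and y lie in [x,y]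
-- (reflexivity), so ι(x,y) ≥ 2 and μ_id(P) ≥ 2ℓ.  Upper bound: for any arc
-- xy the set [x,y] is the vertex set of a path Q of length m; acyclicity
-- forces Q to run from x to y, so ι(x,y) ≤ m + 1 and xy may be replaced by a
-- walk x ⇝ y of m non-loop arcs.  Concatenating these walks along g gives a
-- walk of n arcs with μ_g ≤ n + ℓ; in an acyclic digraph every such walk is
-- a path, so n ≤ ℓ and μ_g ≤ 2ℓ ≤ μ_id(P).

open import Defs
open import Data.Nat using (ℕ; zero; suc; _+_; _*_; _≤_; z≤n; s≤s)
open import Data.Nat.Properties
  using (≤-reflexive; ≤-trans; +-mono-≤; +-monoʳ-≤; +-monoˡ-≤; m≤m+n; m≤n+m;
         +-comm; +-assoc; +-suc; +-identityʳ; *-identityʳ; *-comm; module ≤-Reasoning)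
open import Algebra.Properties.CommutativeMonoid.Sum Data.Nat.Properties.+-0-commutativeMonoid
  using (sum-syntax; ∑-comm; sum-cong-≗; sum-replicate-zero)
  renaming (sum to ∑)
open import Data.Fin using (Fin; inject₁; fromℕ; _<_) renaming (zero to fzero; suc to fsuc)
open import Data.Fin.Properties using (_≟_; <-cmp; ≤fromℕ; ≤∧≢⇒<; 0≢1+n) renaming (suc-injective to fsuc-injective)
open import Data.Bool using (Bool; true; false; _∧_; if_then_else_)
open import Data.Bool.Properties using (∧-conicalˡ; ∧-conicalʳ)
open import Data.List using (map; tabulate; allFin)
open import Data.List.Properties using (map-tabulate)
open import Data.Nat.ListAction using (sum)
open import Data.Product using (Σ; _×_; _,_; proj₁; proj₂)
open import Data.Empty using (⊥-elim)
open import Relation.Binary.PropositionalEquality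
open import Relation.Binary.Definitions using (tri<; tri≈; tri>)
open import Relation.Nullary using (does; yes; no)
open import Relation.Nullary.Decidable using (dec-true)
open import Function.Bundles using (Equivalence)
open import Function using (_∘_; id)

𝟙 : Bool → ℕ
𝟙 b = if b then 1 else 0

sum-tabulate : ∀ n (f : Fin n → ℕ) → sum (tabulate f) ≡ ∑ f
sum-tabulate zero    f = refl
sum-tabulate (suc n) f = cong (f fzero +_) (sum-tabulate n (f ∘ fsuc))

sum-map-allFin : ∀ n (f : Fin n → ℕ) → sum (map f (allFin n)) ≡ ∑ f
sum-map-allFin n f = trans (cong sum (map-tabulate id f)) (sum-tabulate n f)

∑-mono : ∀ n {f g : Fin n → ℕ} → (∀ i → f i ≤ g i) → ∑ f ≤ ∑ g
∑-mono zero    f≤g = z≤n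
∑-mono (suc n) f≤g = +-mono-≤ (f≤g fzero) (∑-mono n (f≤g ∘ fsuc))

∑-const : ∀ n c → ∑[ i < n ] c ≡ n * c
∑-const zero    c = refl
∑-const (suc n) c = cong (c +_) (∑-const n c)

term≤∑ : ∀ n (f : Fin n → ℕ) (k : Fin n) → f k ≤ ∑ f
term≤∑ (suc n) f fzero    = m≤m+n (f fzero) _
term≤∑ (suc n) f (fsuc k) = ≤-trans (term≤∑ n (f ∘ fsuc) k) (m≤n+m _ (f fzero))

twoTerms≤∑ : ∀ n (f : Fin n → ℕ) {a b : Fin n} → a ≢ b → f a + f b ≤ ∑ f
twoTerms≤∑ (suc n) f {fzero}  {fzero}  a≢b = ⊥-elim (a≢b refl)
twoTerms≤∑ (suc n) f {fzero}  {fsuc b} a≢b = +-monoʳ-≤ (f fzero) (term≤∑ n (f ∘ fsuc) b)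
twoTerms≤∑ (suc n) f {fsuc a} {fzero}  a≢b =
  ≤-trans (≤-reflexive (+-comm (f (fsuc a)) (f fzero))) (+-monoʳ-≤ (f fzero) (term≤∑ n (f ∘ fsuc) a))
twoTerms≤∑ (suc n) f {fsuc a} {fsuc b} a≢b =
  ≤-trans (twoTerms≤∑ n (f ∘ fsuc) (a≢b ∘ cong fsuc)) (m≤n+m _ (f fzero))

∑-point : ∀ n (c : Fin n) → ∑[ u < n ] 𝟙 (does (u ≟ c)) ≡ 1
∑-point (suc n) fzero    = cong suc (sum-replicate-zero n)
∑-point (suc n) (fsuc c) = ∑-point n c

count≤cover : ∀ N m (χ : Fin N → Bool) (f : Fin (suc m) → Fin N) →
  (∀ u → χ u ≡ true → Σ (Fin (suc m)) λ k → f k ≡ u) →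
  ∑[ u < N ] 𝟙 (χ u) ≤ suc m
count≤cover N m χ f cover = begin
  ∑[ u < N ] 𝟙 (χ u)                              ≤⟨ ∑-mono N countedBy-f ⟩
  ∑[ u < N ] ∑[ k < suc m ] 𝟙 (does (u ≟ f k))   ≡⟨ ∑-comm (λ u k → 𝟙 (does (u ≟ f k))) ⟩
  ∑[ k < suc m ] ∑[ u < N ] 𝟙 (does (u ≟ f k))   ≡⟨ sum-cong-≗ (∑-point N ∘ f) ⟩
  ∑[ k < suc m ] 1                                ≡⟨ ∑-const (suc m) 1 ⟩
  suc m * 1                                       ≡⟨ *-identityʳ (suc m) ⟩
  suc m                                           ∎
  where
  open ≤-Reasoning
  countedBy-f : ∀ u → 𝟙 (χ u) ≤ ∑[ k < suc m ] 𝟙 (does (u ≟ f k))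
  countedBy-f u with χ u in χu
  ... | false = z≤n
  ... | true with cover u χu
  ...   | k , fk≡u = ≤-trans (≤-reflexive (cong 𝟙 (sym (dec-true (u ≟ f k) (sym fk≡u)))))
                             (term≤∑ (suc m) (λ k → 𝟙 (does (u ≟ f k))) k)

ι-as-∑ : (H : Digraph) (v w : V H) → ι H v w ≡ ∑[ u < suc (size H) ] 𝟙 (arc H v u ∧ arc H u w)
ι-as-∑ H v w = sum-map-allFin (suc (size H)) (λ u → 𝟙 (arc H v u ∧ arc H u w))

ι≤cover : (H : Digraph) (v w : V H) (m : ℕ) (f : Fin (suc m) → V H) →
  (∀ u → InBetween H v w u → Σ (Fin (suc m)) λ k → f k ≡ u) → ι H v w ≤ suc m
ι≤cover H v w m f cover = ≤-trans (≤-reflexive (ι-as-∑ H v w))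
  (count≤cover (suc (size H)) m (λ u → arc H v u ∧ arc H u w) f
    (λ u vuw → cover u (∧-conicalˡ _ _ vuw , ∧-conicalʳ _ _ vuw)))

-- Lower estimate: in a reflexive digraph both ends of a non-loop arc vw lie
-- in [v,w], so ι(v,w) ≥ 2.
ι≥2 : (H : Digraph) → Reflexive H → ∀ {v w} → Arc* H v w → 2 ≤ ι H v w
ι≥2 H refl-H {v} {w} (vw , v≢w) = begin
  2                                                     ≡⟨ sym (cong₂ _+_ (counted (refl-H v) vw) (counted vw (refl-H w))) ⟩
  𝟙 (arc H v v ∧ arc H v w) + 𝟙 (arc H v w ∧ arc H w w) ≤⟨ twoTerms≤∑ _ (λ u → 𝟙 (arc H v u ∧ arc H u w)) v≢w ⟩
  ∑[ u < suc (size H) ] 𝟙 (arc H v u ∧ arc H u w)       ≡⟨ sym (ι-as-∑ H v w) ⟩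
  ι H v w                                               ∎
  where
  open ≤-Reasoning
  counted : ∀ {u} → Arc H v u → Arc H u w → 𝟙 (arc H v u ∧ arc H u w) ≡ 1
  counted vu uw = cong 𝟙 (cong₂ _∧_ vu uw)

_∷ʳ_ : ∀ {G u v w} → Reach⁺ G u v → Arc* G v w → Reach⁺ G u w
step uv   ∷ʳ vw = uv ∷ step vw
(uv ∷ r)  ∷ʳ vw = uv ∷ (r ∷ʳ vw)

Chain : (G : Digraph) (m : ℕ) → (Fin (suc m) → V G) → Set
Chain G m f = ∀ (i : Fin m) → Arc* G (f (inject₁ i)) (f (fsuc i))

chain-reach : ∀ {G} m {f} → Chain G m f → ∀ {i j} → i < j → Reach⁺ G (f i) (f j)
chain-reach (suc m)     ch {fzero}  {fsuc fzero}    _ = step (ch fzero)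
chain-reach (suc m) {f} ch {fzero}  {fsuc (fsuc j)} _ =
  ch fzero ∷ chain-reach m {f ∘ fsuc} (ch ∘ fsuc) {fzero} {fsuc j} (s≤s z≤n)
chain-reach (suc m) {f} ch {fsuc i} {fsuc j} (s≤s i<j) = chain-reach m {f ∘ fsuc} (ch ∘ fsuc) i<j

inject₁≢fsuc : ∀ {n} (i : Fin n) → inject₁ i ≢ fsuc i
inject₁≢fsuc fzero    ()
inject₁≢fsuc (fsuc i) e = inject₁≢fsuc i (fsuc-injective e)

-- The vertices of a path form a chain, as they are distinct.
path-chain : ∀ {G ℓ} (P : Path G ℓ) → Chain G ℓ (vtx P)
path-chain P i = arcs P i , inject₁≢fsuc i ∘ distinct P

data Walk (G : Digraph) : V G → V G → ℕ → Set where
  []  : ∀ {v} → Walk G v v 0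
  _∷_ : ∀ {u v w n} → Arc* G u v → Walk G v w n → Walk G u w (suc n)

_++_ : ∀ {G u v w m n} → Walk G u v m → Walk G v w n → Walk G u w (m + n)
[]      ++ W′ = W′
(a ∷ W) ++ W′ = a ∷ (W ++ W′)

vertices : ∀ {G u w n} → Walk G u w n → Fin (suc n) → V G
vertices {u = u} []      _        = u
vertices {u = u} (a ∷ W) fzero    = u
vertices         (a ∷ W) (fsuc i) = vertices W i

walk-chain : ∀ {G u w n} (W : Walk G u w n) → Chain G n (vertices W)
walk-chain (a ∷ [])      fzero    = a
walk-chain (a ∷ (b ∷ W)) fzero    = a
walk-chain (a ∷ W)       (fsuc i) = walk-chain W i

chain-walk : ∀ {G} m {f : Fin (suc m) → V G} → Chain G m f → Walk G (f fzero) (f (fromℕ m)) m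
chain-walk zero    ch = []
chain-walk (suc m) {f} ch = ch fzero ∷ chain-walk m {f ∘ fsuc} (ch ∘ fsuc)

module AcyclicChains (G : Digraph) (acyclic : Acyclic* G) where

  chain-injective : ∀ {m f} → Chain G m f → ∀ {i j} → f i ≡ f j → i ≡ j
  chain-injective {m} {f} ch {i} {j} fi≡fj with <-cmp i j
  ... | tri< i<j _ _ = ⊥-elim (acyclic _ (subst (Reach⁺ G (f i)) (sym fi≡fj) (chain-reach m {f} ch i<j)))
  ... | tri≈ _ i≡j _ = i≡j
  ... | tri> _ _ j<i = ⊥-elim (acyclic _ (subst (Reach⁺ G (f j)) fi≡fj (chain-reach m {f} ch j<i)))

  walk-path : ∀ {u w n} → Walk G u w n → Path G n
  walk-path W = record
    { vtx      = vertices W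
    ; distinct = chain-injective {f = vertices W} (walk-chain W)
    ; arcs     = proj₁ ∘ walk-chain W }

  chain-first : ∀ {m f} → Chain G m f → ∀ k → Arc G (f k) (f fzero) → k ≡ fzero
  chain-first     ch fzero    _ = refl
  chain-first {m} {f} ch (fsuc j) a = ⊥-elim (acyclic _
    ((a , 0≢1+n ∘ sym ∘ chain-injective {f = f} ch) ∷ chain-reach m {f} ch {fzero} {fsuc j} (s≤s z≤n)))

  chain-last : ∀ {m f} → Chain G m f → ∀ k → Arc G (f (fromℕ m)) (f k) → k ≡ fromℕ m
  chain-last {m} {f} ch k a with k ≟ fromℕ m
  ... | yes k≡last = k≡last
  ... | no  k≢last = ⊥-elim (acyclic _
    (chain-reach m {f} ch (≤∧≢⇒< (≤fromℕ k) k≢last) ∷ʳ (a , k≢last ∘ sym ∘ chain-injective {f = f} ch)))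

μ-as-∑ : ∀ ℓ (H : Digraph) (f : Fin (suc ℓ) → V H) → μ ℓ H f ≡ ∑[ i < ℓ ] ι H (f (inject₁ i)) (f (fsuc i))
μ-as-∑ ℓ H f = sum-map-allFin ℓ (λ i → ι H (f (inject₁ i)) (f (fsuc i)))

μ-step : ∀ ℓ (H : Digraph) (f : Fin (suc (suc ℓ)) → V H) →
  μ (suc ℓ) H f ≡ ι H (f fzero) (f (fsuc fzero)) + μ ℓ H (f ∘ fsuc)
μ-step ℓ H f = trans (μ-as-∑ (suc ℓ) H f) (cong (ι H (f fzero) (f (fsuc fzero)) +_) (sym (μ-as-∑ ℓ H (f ∘ fsuc))))

-- Lower estimate for μ: along a chain of ℓ non-loop arcs in a reflexive
-- digraph every arc contributes at least 2.
chain-μ≥ : ∀ (H : Digraph) → Reflexive H → ∀ ℓ {f} → Chain H ℓ f → ℓ + ℓ ≤ μ ℓ H f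
chain-μ≥ H refl-H ℓ {f} ch = begin
  ℓ + ℓ                                         ≡⟨ cong (ℓ +_) (sym (+-identityʳ ℓ)) ⟩
  2 * ℓ                                         ≡⟨ *-comm 2 ℓ ⟩
  ℓ * 2                                         ≡⟨ sym (∑-const ℓ 2) ⟩
  ∑[ i < ℓ ] 2                                  ≤⟨ ∑-mono ℓ (ι≥2 H refl-H ∘ ch) ⟩
  ∑[ i < ℓ ] ι H (f (inject₁ i)) (f (fsuc i))   ≡⟨ sym (μ-as-∑ ℓ H f) ⟩
  μ ℓ H f                                       ∎
  where open ≤-Reasoning

id-hom : ∀ G → IsHom G G id
id-hom G v w vw = vw

id-strict : ∀ G → IsStrictHom G G id
id-strict G = id-hom G , λ v w vw → vw

module _ (R : Digraph) (acyclic : Acyclic* R) (reflexive : Reflexive R)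
         (between-path : ∀ v w → Arc R v w → IsPathVertexSet R (InBetween R v w)) where

  open AcyclicChains R acyclic

  -- Every arc xy can be replaced by a walk x ⇝ y of m non-loop arcs with
  -- ι(x,y) ≤ m + 1: the path Q spanning [x,y] starts at x and ends at y,
  -- since x has an arc to every vertex of Q and y an arc from every vertex.
  arc-detour : ∀ {x y} → Arc R x y → Σ ℕ λ m → Walk R x y m × ι R x y ≤ suc m
  arc-detour {x} {y} xy with between-path x y xy
  ... | m , Q , spans = m , subst₂ (λ s t → Walk R s t m) starts ends (chain-walk m {q} ch) ,
                        ι≤cover R x y m q (λ u → Equivalence.to (spans u))
    where
    q  = vtx Q
    ch = path-chain Q
    inside : ∀ k → InBetween R x y (q k)
    inside k = Equivalence.from (spans (q k)) (k , refl)
    starts : q fzero ≡ x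
    starts with Equivalence.to (spans x) (reflexive x , xy)
    ... | k , qk≡x = trans (cong q (sym (chain-first {f = q} ch k
                       (subst (λ z → Arc R z (q fzero)) (sym qk≡x) (proj₁ (inside fzero)))))) qk≡x
    ends : q (fromℕ m) ≡ y
    ends with Equivalence.to (spans y) (xy , reflexive y)
    ... | k , qk≡y = trans (cong q (sym (chain-last {f = q} ch k
                       (subst (Arc R (q (fromℕ m))) (sym qk≡y) (proj₂ (inside (fromℕ m))))))) qk≡y

  hom-detour : ∀ ℓ {g} → IsHomPath ℓ R g →
    Σ ℕ λ n → Walk R (g fzero) (g (fromℕ ℓ)) n × μ ℓ R g ≤ n + ℓ
  hom-detour zero        hom = 0 , [] , z≤n
  hom-detour (suc ℓ) {g} hom with arc-detour (hom fzero) | hom-detour ℓ {g ∘ fsuc} (hom ∘ fsuc)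
  ... | m , W , ι≤ | n , W′ , μ≤ = m + n , W ++ W′ , (begin
    μ (suc ℓ) R g                                         ≡⟨ μ-step ℓ R g ⟩
    ι R (g fzero) (g (fsuc fzero)) + μ ℓ R (g ∘ fsuc)     ≤⟨ +-mono-≤ ι≤ μ≤ ⟩
    suc (m + (n + ℓ))                                     ≡⟨ cong suc (sym (+-assoc m n ℓ)) ⟩
    suc (m + n + ℓ)                                       ≡⟨ sym (+-suc (m + n) ℓ) ⟩
    m + n + suc ℓ                                         ∎)
    where open ≤-Reasoning

  -- The inclusion of a longest path maximises μ: μ_g ≤ n + ℓ ≤ 2ℓ ≤ μ_id,
  -- the middle step because the walk of n arcs is itself a path.
  longest-maximizer : ∀ ℓ (P : Path R ℓ) → IsLongestPath R ℓ P → IsMaximizer ℓ R (vtx P)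
  longest-maximizer ℓ P longest = arcs P , μ-bound
    where
    μ-bound : ∀ g → IsHomPath ℓ R g → μ ℓ R g ≤ μ ℓ R (vtx P)
    μ-bound g hom with hom-detour ℓ {g} hom
    ... | n , W , μ≤ = begin
      μ ℓ R g        ≤⟨ μ≤ ⟩
      n + ℓ          ≤⟨ +-monoˡ-≤ ℓ (longest n (walk-path W)) ⟩
      ℓ + ℓ          ≤⟨ chain-μ≥ R reflexive ℓ {vtx P} (path-chain P) ⟩
      μ ℓ R (vtx P)  ∎
      where open ≤-Reasoning

lemma8 : (R : Digraph) → Acyclic* R → Reflexive R →
    (∀ v w → Arc R v w → IsPathVertexSet R (InBetween R v w)) →
    InℜClass R
lemma8 R acyclic reflexive between-path =
  reflexive , acyclic ,
  (id , (id-hom R , longest-maximizer R acyclic reflexive between-path) , id-strict R)
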